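{- Let $G$ be a graph and $\mathcal{E}$ an edge-tangle in $G$. Let $p$ be a positive integer and $[A_1,B_1],\dots,[A_p,B_p]\in\mathcal{E}$. For $1\le i\le p$ let $X_i$ be the set of edges of $G$ with one end in $A_i$ and one in $B_i$. Assume that for every $i$ and every $v\in A_i$ there is a path in $G[A_i]$ from $v$ to an end of an edge in $X_i$, and that the order of $\mathcal{E}$ is greater than $|\bigcup_{i=1}^pX_i|$. If $\bigcup_{i=1}^pX_i$ is free with respect to $\mathcal{E}$ and $X_i\cap X_j=\emptyset$ for all distinct $i,j$, then $A_i\cap A_j=\emptyset$ for all distinct $i,j$.
   Context: Graphs are finite and may have loops and parallel edges. An edge-cut of $G$ is an ordered partition $[A,B]$ of $V(G)$ (parts may be empty), of order equal to the number of edges with one end in $A$ and one in $B$. An edge-tangle of order $\theta$ in $G$ is a set $\mathcal{E}$ of edge-cuts of order less than $\theta$ with (E1) for every edge-cut $[A,B]$ of order less than $\theta$, $[A,B]\in\mathcal{E}$ or $[B,A]\in\mathcal{E}$; (E2) if $[A_i,B_i]\in\mathcal{E}$, $i=1,2,3$, then $B_1\cap B_2\cap B_3\ne\emptyset$; (E3) if $[A,B]\in\mathcal{E}$ then at least $\theta$ edges are incident with vertices of $B$. For $Z\subseteq E(G)$, $\mathcal{E}-Z$ is the set of edge-cuts of $G-Z$ ($G$ with $Z$ deleted) of order in $G-Z$ less than $\theta-|Z|$ that belong to $\mathcal{E}$. A set $X\subseteq E(G)$ is free with respect to $\mathcal{E}$ if there exist no $Z\subseteq X$ and $[A,B]\in\mathcal{E}-Z$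 of order less than $|X-Z|$ such that every edge of $X-Z$ has both ends in $A$. $G[A]$ is the subgraph induced by $A$. -}

module Defs where

open import Data.Nat using (ℕ; _<_; _≤_; _∸_)
open import Data.Bool using (Bool; true; false; _xor_; _∨_; not)
open import Data.Fin using (Fin)
open import Data.Fin.Subset using (Subset; _∈_; _∉_; _⊆_; _∩_; _─_; ∁; ∣_∣; Nonempty)
open import Data.Vec using (lookup; tabulate)
open import Data.Product using (_×_; proj₁; proj₂; Σ; ∃; _,_)
open import Data.Sum using (_⊎_)
open import Relation.Nullary using (¬_)
open import Relation.Binary.PropositionalEquality using (_≡_)

-- A finite graph, loops and parallel edges allowed: vertices Fin nV,
-- edges Fin nE, each edge has an (unordered) pair of ends given as a pair.
record Graph : Set where
  field
    nV   : ℕ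
    nE   : ℕ
    ends : Fin nE → Fin nV × Fin nV
open Graph public

Vtx : Graph → Set
Vtx G = Fin (nV G)

VSet : Graph → Set
VSet G = Subset (nV G)

ESet : Graph → Set
ESet G = Subset (nE G)

-- An edge-cut [A , B] is an ordered partition of V(G); it is determined
-- by its first part A, the second part being B = ∁ A.
EdgeCut : Graph → Set
EdgeCut G = VSet G

side₂ : {G : Graph} → EdgeCut G → VSet G
side₂ A = ∁ A

crossing : (G : Graph) → EdgeCut G → ESet G
crossing G A = tabulate λ e → lookup A (proj₁ (ends G e)) xor lookup A (proj₂ (ends G e))

order : (G : Graph) → EdgeCut G → ℕ
order G A = ∣ crossing G A ∣

-- order of an edge-cut [A,B] in G - Z (same vertex set, edges of Z deleted)
orderDel : (G : Graph) → ESet G → EdgeCut G → ℕ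
orderDel G Z A = ∣ crossing G A ─ Z ∣

incidentWith : (G : Graph) → VSet G → ESet G
incidentWith G B = tabulate λ e → lookup B (proj₁ (ends G e)) ∨ lookup B (proj₂ (ends G e))

CutSet : Graph → Set₁
CutSet G = EdgeCut G → Set

record IsEdgeTangle (G : Graph) (θ : ℕ) (𝓔 : CutSet G) : Set where
  field
    E0 : ∀ A → 𝓔 A → order G A < θ
    E1 : ∀ A → order G A < θ → 𝓔 A ⊎ 𝓔 (side₂ {G} A)
    E2 : ∀ A₁ A₂ A₃ → 𝓔 A₁ → 𝓔 A₂ → 𝓔 A₃ →
           Nonempty (side₂ {G} A₁ ∩ (side₂ {G} A₂ ∩ side₂ {G} A₃))
    E3 : ∀ A → 𝓔 A → θ ≤ ∣ incidentWith G (side₂ {G} A) ∣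

-- 𝓔 - Z : edge-cuts of G - Z of order (in G - Z) less than θ - |Z| lying in 𝓔
delTangle : (G : Graph) (θ : ℕ) → CutSet G → ESet G → CutSet G
delTangle G θ 𝓔 Z A = orderDel G Z A < θ ∸ ∣ Z ∣ × 𝓔 A

bothEndsIn : (G : Graph) → ESet G → VSet G → Set
bothEndsIn G Y A = ∀ e → e ∈ Y → proj₁ (ends G e) ∈ A × proj₂ (ends G e) ∈ A

Free : (G : Graph) (θ : ℕ) → CutSet G → ESet G → Set
Free G θ 𝓔 X =
  ¬ (Σ (ESet G) λ Z → Σ (EdgeCut G) λ A →
       Z ⊆ X × delTangle G θ 𝓔 Z A × orderDel G Z A < ∣ X ─ Z ∣ × bothEndsIn G (X ─ Z) A)

-- u and v are joined by a path (equivalently, a walk) in the induced subgraph G[A]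
data Walk (G : Graph) (A : VSet G) : Vtx G → Vtx G → Set where
  here : ∀ {u} → u ∈ A → Walk G A u u
  step : ∀ {u w v} (e : Fin (nE G)) →
         (ends G e ≡ (u , w) ⊎ ends G e ≡ (w , u)) →
         u ∈ A → Walk G A w v → Walk G A u v

IsEnd : (G : Graph) → Vtx G → Fin (nE G) → Set
IsEnd G v e = proj₁ (ends G e) ≡ v ⊎ proj₂ (ends G e) ≡ v

-- If v ∈ Aᵢ ∩ Aⱼ, follow the walk inside Aᵢ from v to an end of an edge of Xᵢ.
-- Either it leaves Aⱼ, along an edge of Xⱼ with both ends in Aᵢ, or it stays in
-- Aⱼ, and then the final edge, which lies in Xᵢ and hence not in Xⱼ, has both
-- ends in Aⱼ. Either way some cut [A,B] ∈ 𝓔 with boundary inside X = ⋃ Xₖ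
-- has an edge f ∈ X with both ends in A; deleting Z = X − {f} leaves [A,B]
-- of order 0 in G − Z while X − Z = {f} lies in A, contradicting freeness.
module Submission where

open import Defs
open import Data.Nat using (ℕ; _<_; NonZero; _≤_; _∸_)
open import Data.Nat.Properties using (≤-<-trans; m<n⇒0<n∸m)
open import Data.Bool using (true; false; _xor_)
open import Data.Fin using (Fin; zero; suc)
open import Data.Fin.Subset using (Subset; _∈_; _∉_; _⊆_; _─_; ⋃; ⁅_⁆; ∣_∣) renaming (⊥ to ∅)
open import Data.Fin.Subset.Properties
  using (_∈?_; p⊆p∪q; q⊆p∪q; p─q⊆p; x∈⁅y⁆⇒x≡y; p⊆q⇒∣p∣≤∣q∣; ∣⊥∣≡0; ∣⁅x⁆∣≡1)
open import Data.List using (tabulate)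
open import Data.Vec using (_∷_; here; there; lookup)
open import Data.Vec.Properties using ([]=⇒lookup; lookup⇒[]=; lookup∘tabulate)
open import Data.Product using (Σ; ∃; _×_; _,_; proj₁; proj₂)
open import Data.Sum using (_⊎_; inj₁; inj₂)
open import Data.Empty using (⊥)
open import Function using (_∘_; id; case_of_)
open import Relation.Nullary using (¬_; yes; no; contradiction)
open import Relation.Binary.PropositionalEquality
  using (_≡_; _≢_; refl; sym; subst; cong₂; module ≡-Reasoning)

private
  variable
    n : ℕ

∉⇒lookup≡false : ∀ {x : Fin n} {p : Subset n} → x ∉ p → lookup p x ≡ false
∉⇒lookup≡false {x = x} {p} x∉p with lookup p x in eq
... | true  = contradiction (lookup⇒[]= x p eq) x∉p
... | false = refl

x∈p─q⁺ : ∀ {x : Fin n} {p q : Subset n} → x ∈ p → x ∉ q → x ∈ p ─ q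
x∈p─q⁺ {p = _ ∷ _} {false ∷ _} here        x∉q = here
x∈p─q⁺ {p = _ ∷ _} {true ∷ _}  here        x∉q = contradiction here x∉q
x∈p─q⁺ {p = _ ∷ _} {false ∷ _} (there x∈p) x∉q = there (x∈p─q⁺ x∈p (λ x∈q → x∉q (there x∈q)))
x∈p─q⁺ {p = _ ∷ _} {true ∷ _}  (there x∈p) x∉q = there (x∈p─q⁺ x∈p (λ x∈q → x∉q (there x∈q)))

x∈p─q⇒x∉q : ∀ {x : Fin n} (p q : Subset n) → x ∈ p ─ q → x ∉ q
x∈p─q⇒x∉q (true ∷ p) (false ∷ q) here        ()
x∈p─q⇒x∉q (_ ∷ p)    (_ ∷ q)     (there x∈d) (there x∈q) = x∈p─q⇒x∉q p q x∈d x∈q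

r⊆p⇒r─[p─q]⊆q : ∀ {p q r : Subset n} → r ⊆ p → r ─ (p ─ q) ⊆ q
r⊆p⇒r─[p─q]⊆q {p = p} {q} {r} r⊆p {x} x∈d with x ∈? q
... | yes x∈q = x∈q
... | no x∉q  = contradiction (x∈p─q⁺ (r⊆p (p─q⊆p r _ x∈d)) x∉q) (x∈p─q⇒x∉q r (p ─ q) x∈d)

q⊆p⇒q⊆p─[p─q] : ∀ {p q : Subset n} → q ⊆ p → q ⊆ p ─ (p ─ q)
q⊆p⇒q⊆p─[p─q] {p = p} {q} q⊆p x∈q = x∈p─q⁺ (q⊆p x∈q) (λ x∈p─q → x∈p─q⇒x∉q p q x∈p─q x∈q)

⊆⋃-tabulate : ∀ {m} (f : Fin m → Subset n) i → f i ⊆ ⋃ (tabulate f)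
⊆⋃-tabulate f zero    = p⊆p∪q _
⊆⋃-tabulate f (suc i) = q⊆p∪q (f zero) _ ∘ ⊆⋃-tabulate (f ∘ suc) i

module _ {G : Graph} where

  EndsIn : VSet G → Fin (nE G) → Set
  EndsIn A e = proj₁ (ends G e) ∈ A × proj₂ (ends G e) ∈ A

  Joins : Fin (nE G) → Vtx G → Vtx G → Set
  Joins e u w = ends G e ≡ (u , w) ⊎ ends G e ≡ (w , u)

  lookup-crossing : ∀ (A : EdgeCut G) e →
    lookup (crossing G A) e ≡ lookup A (proj₁ (ends G e)) xor lookup A (proj₂ (ends G e))
  lookup-crossing A = lookup∘tabulate _

  ∈crossing⁺ : ∀ {A : EdgeCut G} {e u w} → Joins e u w → u ∈ A → w ∉ A → e ∈ crossing G A
  ∈crossing⁺ {A} {e} {u} {w} joins u∈A w∉A = lookup⇒[]= e (crossing G A) (begin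
      lookup (crossing G A) e                                      ≡⟨ lookup-crossing A e ⟩
      lookup A (proj₁ (ends G e)) xor lookup A (proj₂ (ends G e))  ≡⟨ by-orientation joins ⟩
      true                                                         ∎)
    where
    open ≡-Reasoning
    u↦true : lookup A u ≡ true
    u↦true = []=⇒lookup u∈A
    w↦false : lookup A w ≡ false
    w↦false = ∉⇒lookup≡false w∉A
    by-orientation : Joins e u w →
      lookup A (proj₁ (ends G e)) xor lookup A (proj₂ (ends G e)) ≡ true
    by-orientation (inj₁ refl) = cong₂ _xor_ u↦true w↦false
    by-orientation (inj₂ refl) = cong₂ _xor_ w↦false u↦true

  EndsIn⇒∉crossing : ∀ {A : EdgeCut G} {e} → EndsIn A e → e ∉ crossing G A
  EndsIn⇒∉crossing {A} {e} (x∈A , y∈A) e∈δA = contradiction (begin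
      true                                                         ≡⟨ sym ([]=⇒lookup e∈δA) ⟩
      lookup (crossing G A) e                                      ≡⟨ lookup-crossing A e ⟩
      lookup A (proj₁ (ends G e)) xor lookup A (proj₂ (ends G e))  ≡⟨ cong₂ _xor_ ([]=⇒lookup x∈A) ([]=⇒lookup y∈A) ⟩
      false                                                        ∎) λ ()
    where open ≡-Reasoning

  ∉crossing⇒EndsIn : ∀ {A : EdgeCut G} {e w} → e ∉ crossing G A → IsEnd G w e → w ∈ A → EndsIn A e
  ∉crossing⇒EndsIn {A} {e} e∉δA w-end w∈A with proj₁ (ends G e) ∈? A | proj₂ (ends G e) ∈? A
  ... | yes x∈A | yes y∈A = x∈A , y∈A
  ... | yes x∈A | no y∉A  = contradiction (∈crossing⁺ (inj₁ refl) x∈A y∉A) e∉δA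
  ... | no x∉A  | yes y∈A = contradiction (∈crossing⁺ (inj₂ refl) y∈A x∉A) e∉δA
  ... | no x∉A  | no y∉A  with w-end
  ...   | inj₁ refl = contradiction w∈A x∉A
  ...   | inj₂ refl = contradiction w∈A y∉A

  Walk-start∈ : ∀ {A : VSet G} {u w} → Walk G A u w → u ∈ A
  Walk-start∈ (here u∈A)       = u∈A
  Walk-start∈ (step _ _ u∈A _) = u∈A

  Joins⇒EndsIn : ∀ {A : VSet G} {e u w} → Joins e u w → u ∈ A → w ∈ A → EndsIn A e
  Joins⇒EndsIn (inj₁ refl) u∈A w∈A = u∈A , w∈A
  Joins⇒EndsIn (inj₂ refl) u∈A w∈A = w∈A , u∈A

  walk-leaves-or-ends-in : ∀ {A B : VSet G} {u w} → Walk G A u w → u ∈ B →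
    (∃ λ f → f ∈ crossing G B × EndsIn A f) ⊎ w ∈ B
  walk-leaves-or-ends-in (here _) u∈B = inj₂ u∈B
  walk-leaves-or-ends-in {B = B} (step {w = u′} e joins u∈A rest) u∈B with u′ ∈? B
  ... | yes u′∈B = walk-leaves-or-ends-in rest u′∈B
  ... | no u′∉B  = inj₁ (e , ∈crossing⁺ joins u∈B u′∉B , Joins⇒EndsIn joins u∈A (Walk-start∈ rest))

  Free⇒¬EndsIn : ∀ {θ} {𝓔 : CutSet G} {X : ESet G} {A : EdgeCut G} {f} →
    Free G θ 𝓔 X → ∣ X ∣ < θ → 𝓔 A → crossing G A ⊆ X → f ∈ X → ¬ EndsIn A f
  Free⇒¬EndsIn {θ} {𝓔} {X} {A} {f} free ∣X∣<θ A∈𝓔 δA⊆X f∈X f-in =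
    free (Z , A , p─q⊆p X ⁅ f ⁆ , (orderDel<θ∸∣Z∣ , A∈𝓔) , orderDel<∣X─Z∣ , X─Z-in-A)
    where
    Z = X ─ ⁅ f ⁆

    ⁅f⁆⊆X─Z : ⁅ f ⁆ ⊆ X ─ Z
    ⁅f⁆⊆X─Z = q⊆p⇒q⊆p─[p─q] λ x∈⁅f⁆ → subst (_∈ X) (sym (x∈⁅y⁆⇒x≡y f x∈⁅f⁆)) f∈X

    δA─Z⊆∅ : crossing G A ─ Z ⊆ ∅
    δA─Z⊆∅ {x} x∈δA─Z = contradiction (subst (_∈ crossing G A) x≡f (p─q⊆p _ _ x∈δA─Z)) (EndsIn⇒∉crossing f-in)
      where x≡f = x∈⁅y⁆⇒x≡y f (r⊆p⇒r─[p─q]⊆q δA⊆X x∈δA─Z)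

    orderDel≤0 : orderDel G Z A ≤ 0
    orderDel≤0 = subst (orderDel G Z A ≤_) (∣⊥∣≡0 (nE G)) (p⊆q⇒∣p∣≤∣q∣ δA─Z⊆∅)

    orderDel<θ∸∣Z∣ : orderDel G Z A < θ ∸ ∣ Z ∣
    orderDel<θ∸∣Z∣ = ≤-<-trans orderDel≤0 (m<n⇒0<n∸m (≤-<-trans (p⊆q⇒∣p∣≤∣q∣ (p─q⊆p X ⁅ f ⁆)) ∣X∣<θ))

    orderDel<∣X─Z∣ : orderDel G Z A < ∣ X ─ Z ∣
    orderDel<∣X─Z∣ = ≤-<-trans orderDel≤0 (subst (_≤ ∣ X ─ Z ∣) (∣⁅x⁆∣≡1 f) (p⊆q⇒∣p∣≤∣q∣ ⁅f⁆⊆X─Z))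

    X─Z-in-A : bothEndsIn G (X ─ Z) A
    X─Z-in-A e e∈X─Z = subst (EndsIn A) (sym (x∈⁅y⁆⇒x≡y f (r⊆p⇒r─[p─q]⊆q id e∈X─Z))) f-in

lemma2p10 : (G : Graph) (θ : ℕ) (𝓔 : CutSet G) → IsEdgeTangle G θ 𝓔 →
    (p : ℕ) → .{{_ : NonZero p}} → (A : Fin p → EdgeCut G) → (∀ i → 𝓔 (A i)) →
    (∀ i v → v ∈ A i →
      Σ (Fin (nE G)) λ e → Σ (Vtx G) λ w →
        e ∈ crossing G (A i) × IsEnd G w e × Walk G (A i) v w) →
    ∣ ⋃ (tabulate λ i → crossing G (A i)) ∣ < θ →
    Free G θ 𝓔 (⋃ (tabulate λ i → crossing G (A i))) →
    (∀ i j → i ≢ j → ∀ e → e ∈ crossing G (A i) → e ∈ crossing G (A j) → ⊥) →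
    ∀ i j → i ≢ j → ∀ v → v ∈ A i → v ∈ A j → ⊥
lemma2p10 G θ 𝓔 _ p A A∈𝓔 reach ∣X∣<θ free disjoint i j i≢j v v∈Aᵢ v∈Aⱼ =
  let e , w , e∈Xᵢ , w-end , walk = reach i v v∈Aᵢ in
  case walk-leaves-or-ends-in walk v∈Aⱼ of λ where
    (inj₁ (f , f∈Xⱼ , f-in-Aᵢ)) →
      Free⇒¬EndsIn free ∣X∣<θ (A∈𝓔 i) (Xₖ⊆X i) (Xₖ⊆X j f∈Xⱼ) f-in-Aᵢ
    (inj₂ w∈Aⱼ) →
      Free⇒¬EndsIn free ∣X∣<θ (A∈𝓔 j) (Xₖ⊆X j) (Xₖ⊆X i e∈Xᵢ)
        (∉crossing⇒EndsIn (disjoint i j i≢j e e∈Xᵢ) w-end w∈Aⱼ)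
  where
  Xₖ⊆X : ∀ k → crossing G (A k) ⊆ ⋃ (tabulate λ k → crossing G (A k))
  Xₖ⊆X = ⊆⋃-tabulate (λ k → crossing G (A k))
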